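{- Let $r,s,t\geq 0$ be integers and let $l_1,\dots,l_r$, $m_1,\dots,m_s$, $n_1,\dots,n_t$ be positive integers. Let $T$ be the disjoint union of the games $F(l_1),\dots,F(l_r)$, $G(m_1),\dots,G(m_s)$ and $H(n_1),\dots,H(n_t)$, played with Maker having the first move, and let $f(\underline{l};\underline{m};\underline{n})$ be its score under optimal play. Let (with congruences modulo $5$) $N_1=|\{i: l_i\equiv 3\text{ or }4\}|$, $N_2=|\{i: m_i\equiv 0\text{ or }1\}|$, $N_3=|\{i: n_i\neq 2\text{ and } n_i\equiv 2\text{ or }3\}|$, $N_4=|\{i: n_i=2\}|$, $N_5=|\{i: n_i=1\}|$, and let $\epsilon\in\{0,1\}$ with $N_5\equiv\epsilon \pmod 2$. Then \[ f(\underline{l};\underline{m};\underline{n})\le\sum_{i=1}^{r}\left\lfloor \frac{l_i+2}{5}\right\rfloor+\sum_{i=1}^{s}\left\lfloor \frac{m_i+5}{5}\right\rfloor+\sum_{i=1}^{t}\left\lfloor \frac{n_i+8}{5}\right\rfloor-N_4+\epsilon-\left\lfloor \frac{N_1+N_2+N_3+\epsilon}{2}\right\rfloor . \]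
   Context: All games are played by Maker and Breaker who alternately claim previously unclaimed elements of the board until all are claimed; Maker aims to maximise the score, Breaker to minimise it. Single boards: $F(n)$ is played on $\{1,\dots,n\}$ and its score is the number of pairs $\{i,i+1\}$ with both elements claimed by Maker. $G(n)$ is played on $\{1,\dots,n\}$ with score equal to the number of adjacent pairs $\{i,i+1\}$, $0\le i\le n-1$, claimed by Maker when the board is regarded as $\{0,\dots,n\}$ with $0$ considered claimed by Maker from the start (i.e. adjacent Maker pairs plus $1$ if Maker claims $1$). $H(n)$ is played on $\{1,\dots,n\}$ with score equal to the number of adjacent pairs $\{i,i+1\}$, $0\le i\le n$, claimed by Maker when the board is regarded as $\{0,\dots,n+1\}$ with $0$ and $n+1$ considered claimed by Maker from the start. A disjoint union of such games is the game in which on each turn the player to move claims one unclaimed element from any one of the component boards, and the total score is the sum of the scores of the components. -}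

module Defs where

open import Data.Nat using (ℕ; zero; suc; _+_; _⊔_; _⊓_; _/_; _%_; _≡ᵇ_)
open import Data.Bool using (Bool; true; false; _∧_; _∨_; not; if_then_else_)
open import Data.List using (List; []; _∷_; _++_; map; foldr; replicate; length)
open import Data.Nat.ListAction using (sum)
open import Data.Product using (_×_; _,_)

data Cell : Set where
  free maker breaker : Cell

data Kind : Set where
  KF KG KH : Kind

data Player : Set where
  Maker Breaker : Player

owner : Player → Cell
owner Maker   = maker
owner Breaker = breaker

other : Player → Player
other Maker   = Breaker
other Breaker = Maker

-- A position of the disjoint union: list of components, each a kind
-- together with the states of its elements 1..n (in order).
Component : Set
Component = Kind × List Cell

Position : Set
Position = List Component

isMaker : Cell → Bool
isMaker maker = true
isMaker _     = false

isFree : Cell → Bool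
isFree free = true
isFree _    = false

adj : List Cell → ℕ
adj [] = 0
adj (x ∷ []) = 0
adj (x ∷ y ∷ cs) = (if isMaker x ∧ isMaker y then 1 else 0) + adj (y ∷ cs)

componentScore : Component → ℕ
componentScore (KF , cs) = adj cs
componentScore (KG , cs) = adj (maker ∷ cs)                 -- element 0 is Maker's
componentScore (KH , cs) = adj (maker ∷ (cs ++ (maker ∷ [])))  -- 0 and n+1 are Maker's

score : Position → ℕ
score p = sum (map componentScore p)

countFree : List Cell → ℕ
countFree [] = 0
countFree (c ∷ cs) = (if isFree c then 1 else 0) + countFree cs

freeCells : Position → ℕ
freeCells p = sum (map (λ { (_ , cs) → countFree cs }) p)

claimC : Cell → List Cell → List (List Cell)
claimC o [] = []
claimC o (free ∷ cs)    = (o ∷ cs) ∷ map (free ∷_) (claimC o cs)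
claimC o (maker ∷ cs)   = map (maker ∷_) (claimC o cs)
claimC o (breaker ∷ cs) = map (breaker ∷_) (claimC o cs)

claimP : Cell → Position → List Position
claimP o [] = []
claimP o ((k , cs) ∷ ps) =
  map (λ cs' → (k , cs') ∷ ps) (claimC o cs) ++ map ((k , cs) ∷_) (claimP o ps)

combine : Player → ℕ → List ℕ → ℕ
combine Maker   x xs = foldr _⊔_ x xs
combine Breaker x xs = foldr _⊓_ x xs

-- Minimax value (Maker maximises, Breaker minimises) with the given player
-- to move; the fuel argument bounds the number of remaining moves.
value : ℕ → Player → Position → ℕ
value zero _ p = score p
value (suc k) pl p with claimP (owner pl) p
... | [] = score p
... | q ∷ qs = combine pl (value k (other pl) q) (map (value k (other pl)) qs)

initial : List ℕ → List ℕ → List ℕ → Position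
initial ls ms ns =
  map (λ l → (KF , replicate l free)) ls ++
  map (λ m → (KG , replicate m free)) ms ++
  map (λ n → (KH , replicate n free)) ns

f : List ℕ → List ℕ → List ℕ → ℕ
f ls ms ns = value (freeCells (initial ls ms ns)) Maker (initial ls ms ns)

count : (ℕ → Bool) → List ℕ → ℕ
count P [] = 0
count P (x ∷ xs) = (if P x then 1 else 0) + count P xs

N₁ : List ℕ → ℕ
N₁ ls = count (λ l → (l % 5 ≡ᵇ 3) ∨ (l % 5 ≡ᵇ 4)) ls

N₂ : List ℕ → ℕ
N₂ ms = count (λ m → (m % 5 ≡ᵇ 0) ∨ (m % 5 ≡ᵇ 1)) ms

N₃ : List ℕ → ℕ
N₃ ns = count (λ n → not (n ≡ᵇ 2) ∧ ((n % 5 ≡ᵇ 2) ∨ (n % 5 ≡ᵇ 3))) ns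

N₄ : List ℕ → ℕ
N₄ ns = count (λ n → n ≡ᵇ 2) ns

N₅ : List ℕ → ℕ
N₅ ns = count (λ n → n ≡ᵇ 1) ns

ε : List ℕ → ℕ
ε ns = N₅ ns % 2

sumF : List ℕ → ℕ
sumF ls = sum (map (λ l → (l + 2) / 5) ls)

sumG : List ℕ → ℕ
sumG ms = sum (map (λ m → (m + 5) / 5) ms)

sumH : List ℕ → ℕ
sumH ns = sum (map (λ n → (n + 8) / 5) ns)

-- A position is read as the sum of its runs of free cells: a run of length n
-- between claimed cells counts as F(n), G(n) or H(n) according to how many of
-- its ends are Maker's. The right-hand side of the statement, evaluated on
-- these runs and increased by the pairs Maker already owns, bounds the value
-- with Maker to move. When Maker claims a cell of a run of length at least 2,
-- Breaker claims a neighbour and the bound does not grow. When Maker fills a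
-- run of length 1, Breaker splits some other run so as to pay the change in the
-- parity of N₁ + N₂ + N₃ + ε, which is possible unless no floor terms are left;
-- if the filled run was H(1) and an odd number of H(1) remain, Breaker fills
-- one of them instead. Each local inequality sees its context only through two
-- parities and is periodic with period 5 in run lengths beyond 8, so it is
-- settled by a finite computation.

module Submission where

open import Defs
open import Data.Bool using (Bool; true; false; T; _∧_; _∨_; not; if_then_else_)
open import Data.Bool.ListAction using (all)
open import Data.Empty using (⊥; ⊥-elim)
open import Data.List using (List; []; _∷_; _++_; map; replicate; foldr; upTo)
open import Data.List.Membership.Propositional using (_∈_; find)
open import Data.List.Membership.Propositional.Properties using (∈-upTo⁺; ∈-map⁺)
open import Data.List.Properties using (map-∘; map-++; ∷-injectiveˡ; ∷-injectiveʳ)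
open import Data.List.Relation.Unary.All as All using (All; []; _∷_)
import Data.List.Relation.Unary.All.Properties as All
open import Data.List.Relation.Unary.Any as Any using (Any; here; there)
import Data.List.Relation.Unary.Any.Properties as Any
open import Data.Nat
  using (ℕ; zero; suc; _+_; _≤_; _<_; _/_; _%_; _≤ᵇ_; _≡ᵇ_; _⊔_; _⊓_; ⌊_/2⌋; z≤n; s≤s; z<s)
open import Data.Nat.DivMod using (m/n≡1+[m∸n]/n)
open import Data.Nat.Induction using (<-rec)
open import Data.Nat.Properties
open import Data.Nat.Tactic.RingSolver using (solve-∀)
open import Data.Product using (∃; _×_; _,_)
open import Data.Sum using (_⊎_; inj₁; inj₂)
open import Data.Unit using (tt; ⊤)
open import Relation.Binary.PropositionalEquality
open import Relation.Nullary using (yes; no)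

-- A profile summarises a set of runs of free cells: the pairs already made by
-- Maker, the sum of the floor terms of the statement, and the contributions to
-- N₁ + N₂ + N₃, to N₅ and to N₄.
record Profile : Set where
  constructor ⟨_,_,_,_,_⟩
  field
    made floors n₁₂₃ n₅ n₄ : ℕ
open Profile

infixr 6 _⊕_
_⊕_ : Profile → Profile → Profile
x ⊕ y =
  ⟨ made x + made y , floors x + floors y , n₁₂₃ x + n₁₂₃ y , n₅ x + n₅ y , n₄ x + n₄ y ⟩

𝟘 : Profile
𝟘 = ⟨ 0 , 0 , 0 , 0 , 0 ⟩

profile-≡ : ∀ {x y} → made x ≡ made y → floors x ≡ floors y → n₁₂₃ x ≡ n₁₂₃ y →
            n₅ x ≡ n₅ y → n₄ x ≡ n₄ y → x ≡ y
profile-≡ refl refl refl refl refl = refl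

⊕-assoc : ∀ x y z → (x ⊕ y) ⊕ z ≡ x ⊕ (y ⊕ z)
⊕-assoc x y z = profile-≡ (+-assoc (made x) _ _) (+-assoc (floors x) _ _)
  (+-assoc (n₁₂₃ x) _ _) (+-assoc (n₅ x) _ _) (+-assoc (n₄ x) _ _)

⊕-comm : ∀ x y → x ⊕ y ≡ y ⊕ x
⊕-comm x y = profile-≡ (+-comm (made x) _) (+-comm (floors x) _)
  (+-comm (n₁₂₃ x) _) (+-comm (n₅ x) _) (+-comm (n₄ x) _)

⊕-identityʳ : ∀ x → x ⊕ 𝟘 ≡ x
⊕-identityʳ x = profile-≡ (+-identityʳ _) (+-identityʳ _) (+-identityʳ _)
  (+-identityʳ _) (+-identityʳ _)

⊕-swap : ∀ x y z → x ⊕ (y ⊕ z) ≡ y ⊕ (x ⊕ z)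
⊕-swap x y z = begin
  x ⊕ (y ⊕ z)  ≡⟨ ⊕-assoc x y z ⟨
  (x ⊕ y) ⊕ z  ≡⟨ cong (_⊕ z) (⊕-comm x y) ⟩
  (y ⊕ x) ⊕ z  ≡⟨ ⊕-assoc y x z ⟩
  y ⊕ (x ⊕ z)  ∎
  where open ≡-Reasoning

ContextClosed : (Profile → Profile → Set) → Set
ContextClosed R = ∀ e {d d'} → R d d' → R (e ⊕ d) (e ⊕ d')

closed-⊕ʳ : ∀ {R} → ContextClosed R → ∀ e {d d'} → R d d' → R (d ⊕ e) (d' ⊕ e)
closed-⊕ʳ {R} closed e {d} {d'} r = subst₂ R (⊕-comm e d) (⊕-comm e d') (closed e r)

-- The bound on the value is credit − debit; ε of the statement is n₅ % 2.
credit : Profile → ℕ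
credit d = made d + floors d + n₅ d % 2

debit : Profile → ℕ
debit d = n₄ d + ⌊ n₁₂₃ d + n₅ d % 2 /2⌋

parityDefect : Profile → ℕ
parityDefect d = (n₁₂₃ d + n₅ d % 2) % 2

infix 4 _≼_
_≼_ : ℕ → Profile → Set
x ≼ d = x + debit d ≤ credit d

-- Passing from d to d' lowers credit − debit by at least the parity defect of
-- d (if strict) or does not raise it (otherwise).
Descent : Bool → Profile → Profile → Set
Descent strict d d' =
  credit d' + debit d + (if strict then parityDefect d else 0) ≤ credit d + debit d'

Local : Bool → Profile → Profile → Set
Local strict d d' = ∀ e → Descent strict (e ⊕ d) (e ⊕ d')

local-⊕ˡ : ∀ {s} → ContextClosed (Local s)
local-⊕ˡ {s} u {d} {d'} g e = subst₂ (Descent s) (⊕-assoc e u d) (⊕-assoc e u d') (g (e ⊕ u))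

descent-weaken : ∀ d d' → Descent true d d' → Descent false d d'
descent-weaken d d' h = ≤-trans (+-monoʳ-≤ _ z≤n) h

-- Only the parities of n₁₂₃ and n₅ of a context matter.
parityContext : Profile → Profile
parityContext e = ⟨ 0 , 0 , n₁₂₃ e % 2 , n₅ e % 2 , 0 ⟩

%2-+ : ∀ m x → (m + x) % 2 ≡ (m % 2 + x) % 2
%2-+ zero          x = refl
%2-+ (suc zero)    x = refl
%2-+ (suc (suc m)) x = %2-+ m x

⌊/2⌋-+ : ∀ m x → ⌊ m + x /2⌋ ≡ ⌊ m /2⌋ + ⌊ m % 2 + x /2⌋
⌊/2⌋-+ zero          x = refl
⌊/2⌋-+ (suc zero)    x = refl
⌊/2⌋-+ (suc (suc m)) x = cong suc (⌊/2⌋-+ m x)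

%2-cases : ∀ m → m % 2 ≡ 0 ⊎ m % 2 ≡ 1
%2-cases zero          = inj₁ refl
%2-cases (suc zero)    = inj₂ refl
%2-cases (suc (suc m)) = %2-cases m

credit-⊕ : ∀ e x → credit (e ⊕ x) ≡ (made e + floors e) + credit (parityContext e ⊕ x)
credit-⊕ e x rewrite %2-+ (n₅ e) (n₅ x) =
  shuffle (made e) (made x) (floors e) (floors x) ((n₅ e % 2 + n₅ x) % 2)
  where
  shuffle : ∀ a b c d z → a + b + (c + d) + z ≡ a + c + (b + d + z)
  shuffle = solve-∀

debit-⊕ : ∀ e x → debit (e ⊕ x) ≡ (n₄ e + ⌊ n₁₂₃ e /2⌋) + debit (parityContext e ⊕ x)
debit-⊕ e x = begin
  n₄ e + n₄ x + ⌊ n₁₂₃ e + n₁₂₃ x + P /2⌋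
    ≡⟨ cong (λ z → n₄ e + n₄ x + ⌊ z /2⌋) (+-assoc (n₁₂₃ e) (n₁₂₃ x) P) ⟩
  n₄ e + n₄ x + ⌊ n₁₂₃ e + (n₁₂₃ x + P) /2⌋
    ≡⟨ cong (n₄ e + n₄ x +_) (⌊/2⌋-+ (n₁₂₃ e) (n₁₂₃ x + P)) ⟩
  n₄ e + n₄ x + (⌊ n₁₂₃ e /2⌋ + ⌊ n₁₂₃ e % 2 + (n₁₂₃ x + P) /2⌋)
    ≡⟨ shuffle (n₄ e) (n₄ x) ⌊ n₁₂₃ e /2⌋ _ ⟩
  n₄ e + ⌊ n₁₂₃ e /2⌋ + (n₄ x + ⌊ n₁₂₃ e % 2 + (n₁₂₃ x + P) /2⌋)
    ≡⟨ cong (λ z → n₄ e + ⌊ n₁₂₃ e /2⌋ + (n₄ x + ⌊ z /2⌋))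
            (+-assoc (n₁₂₃ e % 2) (n₁₂₃ x) P) ⟨
  n₄ e + ⌊ n₁₂₃ e /2⌋ + (n₄ x + ⌊ n₁₂₃ e % 2 + n₁₂₃ x + P /2⌋)
    ≡⟨ cong (λ z → n₄ e + ⌊ n₁₂₃ e /2⌋ + (n₄ x + ⌊ n₁₂₃ e % 2 + n₁₂₃ x + z /2⌋))
            (%2-+ (n₅ e) (n₅ x)) ⟩
  n₄ e + ⌊ n₁₂₃ e /2⌋ + debit (parityContext e ⊕ x)  ∎
  where
  open ≡-Reasoning
  P = (n₅ e + n₅ x) % 2
  shuffle : ∀ a b c d → a + b + (c + d) ≡ a + c + (b + d)
  shuffle = solve-∀

parityDefect-⊕ : ∀ e x → parityDefect (e ⊕ x) ≡ parityDefect (parityContext e ⊕ x)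
parityDefect-⊕ e x = begin
  (n₁₂₃ e + n₁₂₃ x + P) % 2
    ≡⟨ cong (_% 2) (+-assoc (n₁₂₃ e) (n₁₂₃ x) P) ⟩
  (n₁₂₃ e + (n₁₂₃ x + P)) % 2
    ≡⟨ %2-+ (n₁₂₃ e) (n₁₂₃ x + P) ⟩
  (n₁₂₃ e % 2 + (n₁₂₃ x + P)) % 2
    ≡⟨ cong (_% 2) (+-assoc (n₁₂₃ e % 2) (n₁₂₃ x) P) ⟨
  (n₁₂₃ e % 2 + n₁₂₃ x + P) % 2
    ≡⟨ cong (λ z → (n₁₂₃ e % 2 + n₁₂₃ x + z) % 2) (%2-+ (n₅ e) (n₅ x)) ⟩
  parityDefect (parityContext e ⊕ x) ∎
  where
  open ≡-Reasoning
  P = (n₅ e + n₅ x) % 2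

descent-parityContext : ∀ s e d d' →
  Descent s (parityContext e ⊕ d) (parityContext e ⊕ d') → Descent s (e ⊕ d) (e ⊕ d')
descent-parityContext s e d d' h
  rewrite credit-⊕ e d | credit-⊕ e d' | debit-⊕ e d | debit-⊕ e d' | parityDefect-⊕ e d =
  shift (made e + floors e) (n₄ e + ⌊ n₁₂₃ e /2⌋) h
  where
  shift : ∀ {a b a' b' m} C D → a' + b + m ≤ a + b' → C + a' + (D + b) + m ≤ C + a + (D + b')
  shift {a} {b} {a'} {b'} {m} C D le =
    subst₂ _≤_ (reorder₃ C D a' b m) (reorder₂ C D a b') (+-monoʳ-≤ (C + D) le)
    where
    reorder₃ : ∀ C D x y z → C + D + (x + y + z) ≡ C + x + (D + y) + z
    reorder₃ = solve-∀
    reorder₂ : ∀ C D x y → C + D + (x + y) ≡ C + x + (D + y)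
    reorder₂ = solve-∀

descent? : Bool → Profile → Profile → Bool
descent? s d d' = credit d' + debit d + (if s then parityDefect d else 0) ≤ᵇ credit d + debit d'

parityContexts : List Profile
parityContexts = ⟨ 0 , 0 , 0 , 0 , 0 ⟩ ∷ ⟨ 0 , 0 , 0 , 1 , 0 ⟩
                ∷ ⟨ 0 , 0 , 1 , 0 , 0 ⟩ ∷ ⟨ 0 , 0 , 1 , 1 , 0 ⟩ ∷ []

parityContext∈ : ∀ e → parityContext e ∈ parityContexts
parityContext∈ e with n₁₂₃ e % 2 | %2-cases (n₁₂₃ e) | n₅ e % 2 | %2-cases (n₅ e)
... | _ | inj₁ refl | _ | inj₁ refl = here refl
... | _ | inj₁ refl | _ | inj₂ refl = there (here refl)
... | _ | inj₂ refl | _ | inj₁ refl = there (there (here refl))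
... | _ | inj₂ refl | _ | inj₂ refl = there (there (there (here refl)))

local? : Bool → Profile → Profile → Bool
local? s d d' = all (λ c → descent? s (c ⊕ d) (c ⊕ d')) parityContexts

local?-sound : ∀ s d d' → T (local? s d d') → Local s d d'
local?-sound s d d' ok e = descent-parityContext s e d d' (≤ᵇ⇒≤ _ _
  (All.lookup (All.all⁺ (λ c → descent? s (c ⊕ d) (c ⊕ d')) parityContexts ok) (parityContext∈ e)))

all-upTo : ∀ (p : ℕ → Bool) {n i} → T (all p (upTo n)) → i < n → T (p i)
all-upTo p {n} ok i<n = All.lookup (All.all⁺ p (upTo n) ok) (∈-upTo⁺ i<n)

periodic : ∀ t (P : ℕ → Set) → (∀ m → P (t + m) → P (5 + t + m)) →
           (∀ {n} → n < 5 + t → P n) → ∀ n → P n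
periodic t P step small = <-rec P go
  where
  go : ∀ n → (∀ {m} → m < n → P m) → P n
  go n rec with n <? 5 + t
  ... | yes n<5+t = small n<5+t
  ... | no n≮5+t with m≤n⇒∃[o]m+o≡n (≮⇒≥ n≮5+t)
  ...   | m , refl = step m (rec (+-monoˡ-< m (m<n+m t {5} z<s)))

-- run X n Y: n free cells between two claimed cells, X and Y telling whether
-- these are Maker's; such a run plays the role of F(n), G(n) or H(n).
fRun gRun hRun : ℕ → Profile
fRun n = ⟨ 0 , (n + 2) / 5 , (if (n % 5 ≡ᵇ 3) ∨ (n % 5 ≡ᵇ 4) then 1 else 0) , 0 , 0 ⟩
gRun n = ⟨ 0 , (n + 5) / 5 , (if (n % 5 ≡ᵇ 0) ∨ (n % 5 ≡ᵇ 1) then 1 else 0) , 0 , 0 ⟩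
hRun n = ⟨ 0 , (n + 8) / 5 , (if not (n ≡ᵇ 2) ∧ ((n % 5 ≡ᵇ 2) ∨ (n % 5 ≡ᵇ 3)) then 1 else 0)
         , (if n ≡ᵇ 1 then 1 else 0) , (if n ≡ᵇ 2 then 1 else 0) ⟩

run : Bool → ℕ → Bool → Profile
run X     zero      Y     = ⟨ (if X ∧ Y then 1 else 0) , 0 , 0 , 0 , 0 ⟩
run false n@(suc _) false = fRun n
run false n@(suc _) true  = gRun n
run true  n@(suc _) false = gRun n
run true  n@(suc _) true  = hRun n

oneFloor : Profile
oneFloor = ⟨ 0 , 1 , 0 , 0 , 0 ⟩

[5+n]/5 : ∀ n → (5 + n) / 5 ≡ suc (n / 5)
[5+n]/5 n = m/n≡1+[m∸n]/n (m≤m+n 5 n)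

run-periodic : ∀ X m Y → run X (8 + m) Y ≡ oneFloor ⊕ run X (3 + m) Y
run-periodic false m false = profile-≡ refl ([5+n]/5 (3 + m + 2)) refl refl refl
run-periodic false m true  = profile-≡ refl ([5+n]/5 (3 + m + 5)) refl refl refl
run-periodic true  m false = profile-≡ refl ([5+n]/5 (3 + m + 5)) refl refl refl
run-periodic true  m true  = profile-≡ refl ([5+n]/5 (3 + m + 8)) refl refl refl

run-periodic-≥3 : ∀ X {n} Y → 3 ≤ n → run X (5 + n) Y ≡ oneFloor ⊕ run X n Y
run-periodic-≥3 X Y (s≤s (s≤s (s≤s {n = m} z≤n))) = run-periodic X m Y

Balanced : Profile → Set
Balanced d = n₁₂₃ d + n₄ d + n₅ d ≤ floors d

balanced-⊕ : ∀ x y → Balanced x → Balanced y → Balanced (x ⊕ y)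
balanced-⊕ x y bx by = subst (_≤ floors x + floors y)
  (shuffle (n₁₂₃ x) (n₁₂₃ y) (n₄ x) (n₄ y) (n₅ x) (n₅ y)) (+-mono-≤ bx by)
  where
  shuffle : ∀ a b c d e f → a + c + e + (b + d + f) ≡ a + b + (c + d) + (e + f)
  shuffle = solve-∀

run-balanced : ∀ X Y n → Balanced (run X n Y)
run-balanced X Y = periodic 3 (λ n → Balanced (run X n Y)) step
  (λ n<8 → ≤ᵇ⇒≤ _ _ (all-upTo (λ n → balanced? (run X n Y)) (small X Y) n<8))
  where
  balanced? : Profile → Bool
  balanced? d = n₁₂₃ d + n₄ d + n₅ d ≤ᵇ floors d
  step : ∀ m → Balanced (run X (3 + m) Y) → Balanced (run X (8 + m) Y)
  step m b rewrite run-periodic X m Y = m≤n⇒m≤1+n b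
  small : ∀ X Y → T (all (λ n → balanced? (run X n Y)) (upTo 8))
  small false false = tt
  small false true  = tt
  small true  false = tt
  small true  true  = tt

local-shift : ∀ {s d d' D D'} → D ≡ oneFloor ⊕ d → D' ≡ oneFloor ⊕ d' →
              Local s d d' → Local s D D'
local-shift refl refl = local-⊕ˡ oneFloor

local-periodic : ∀ s (d d' : ℕ → Profile) →
  (∀ m → d (8 + m) ≡ oneFloor ⊕ d (3 + m)) → (∀ m → d' (8 + m) ≡ oneFloor ⊕ d' (3 + m)) →
  T (all (λ n → local? s (d n) (d' n)) (upTo 8)) → ∀ n → Local s (d n) (d' n)
local-periodic s d d' dₚ d'ₚ ok = periodic 3 (λ n → Local s (d n) (d' n))
  (λ m → local-shift (dₚ m) (d'ₚ m))
  (λ n<8 → local?-sound s _ _ (all-upTo (λ n → local? s (d n) (d' n)) ok n<8))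

Split : Bool → Bool → Bool → ℕ → Set
Split s X Y n =
  ∃ λ u → ∃ λ v → u + suc v ≡ n × Local s (run X n Y) (run X u false ⊕ run false v Y)

nextToMakerˡ : ∀ Y m → Local true (run true (suc m) Y) (run true 0 false ⊕ run false m Y)
nextToMakerˡ Y = local-periodic true
  (λ m → run true (suc m) Y) (λ m → run true 0 false ⊕ run false m Y)
  (λ m → run-periodic true (suc m) Y)
  (λ m → trans (cong (run true 0 false ⊕_) (run-periodic false m Y))
               (⊕-swap (run true 0 false) oneFloor (run false (3 + m) Y)))
  (small Y)
  where
  small : ∀ Y →
    T (all (λ m → local? true (run true (suc m) Y) (run true 0 false ⊕ run false m Y)) (upTo 8))
  small false = tt
  small true  = tt

nextToMakerʳ : ∀ m → Local true (run false (suc m) true) (run false m false ⊕ run false 0 true)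
nextToMakerʳ = local-periodic true
  (λ m → run false (suc m) true) (λ m → run false m false ⊕ run false 0 true)
  (λ m → run-periodic false (suc m) true)
  (λ m → trans (cong (_⊕ run false 0 true) (run-periodic false m false))
               (⊕-assoc oneFloor (run false (3 + m) false) (run false 0 true)))
  tt

thirdCell : ∀ m → Local true (run false (3 + m) false) (run false 2 false ⊕ run false m false)
thirdCell = local-periodic true
  (λ m → run false (3 + m) false) (λ m → run false 2 false ⊕ run false m false)
  (λ m → run-periodic false (3 + m) false)
  (λ m → trans (cong (run false 2 false ⊕_) (run-periodic false m false))
               (⊕-swap (run false 2 false) oneFloor (run false (3 + m) false)))
  tt

RunSplit : Bool → Bool → ℕ → Set
RunSplit X Y n = Split true X Y n ⊎ (floors (run X n Y) ≡ 0 × Split false X Y n)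

-- Breaker splits a run next to a Maker end, or at its third cell; only F-runs
-- of length 1 or 2 (which carry no floor term) may lack a strict split.
breakerSplit : ∀ X Y m → RunSplit X Y (suc m)
breakerSplit true  Y    m             = inj₁ (0 , m , refl , nextToMakerˡ Y m)
breakerSplit false true m             = inj₁ (m , 0 , +-comm m 1 , nextToMakerʳ m)
breakerSplit false false zero          = inj₂ (refl , 0 , 0 , refl , local?-sound false _ _ tt)
breakerSplit false false (suc zero)    = inj₂ (refl , 0 , 1 , refl , local?-sound false _ _ tt)
breakerSplit false false (suc (suc m)) = inj₁ (2 , m , refl , thirdCell m)

-- Maker has claimed cell i of a run of i + 1 + j cells; Breaker claims a neighbour.
AdjacentReply : Bool → Bool → ℕ → ℕ → Set
AdjacentReply X Y i j =
    (∃ λ i' → i ≡ suc i' ×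
      Local false (run X (i + suc j) Y) (run X i' false ⊕ run false 0 true ⊕ run true j Y))
  ⊎ (∃ λ j' → j ≡ suc j' ×
      Local false (run X (i + suc j) Y) (run X i true ⊕ run true 0 false ⊕ run false j' Y))

leftReply? rightReply? : Bool → Bool → ℕ → ℕ → Bool
leftReply? X Y zero     j = false
leftReply? X Y (suc i') j =
  local? false (run X (suc i' + suc j) Y) (run X i' false ⊕ run false 0 true ⊕ run true j Y)
rightReply? X Y i zero     = false
rightReply? X Y i (suc j') =
  local? false (run X (i + suc (suc j')) Y) (run X i true ⊕ run true 0 false ⊕ run false j' Y)

adjacentReply?-sound : ∀ X Y i j →
  T (leftReply? X Y i j) ⊎ T (rightReply? X Y i j) → AdjacentReply X Y i j
adjacentReply?-sound X Y zero     j        (inj₁ ())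
adjacentReply?-sound X Y (suc i') j        (inj₁ ok) = inj₁ (i' , refl , local?-sound false _ _ ok)
adjacentReply?-sound X Y i        zero     (inj₂ ())
adjacentReply?-sound X Y i        (suc j') (inj₂ ok) = inj₂ (j' , refl , local?-sound false _ _ ok)

⊕-pullˡ : ∀ a b c → a ⊕ b ⊕ (oneFloor ⊕ c) ≡ oneFloor ⊕ (a ⊕ b ⊕ c)
⊕-pullˡ a b c = trans (cong (a ⊕_) (⊕-swap b oneFloor c)) (⊕-swap a oneFloor (b ⊕ c))

adjacentReply-shiftˡ : ∀ X Y i j → AdjacentReply X Y (4 + i) j → AdjacentReply X Y (9 + i) j
adjacentReply-shiftˡ X Y i j (inj₁ (_ , refl , g)) = inj₁ (_ , refl ,
  local-shift (run-periodic X (suc i + suc j) Y)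
    (trans (cong (_⊕ rest) (run-periodic X i false)) (⊕-assoc oneFloor (run X (3 + i) false) rest)) g)
  where rest = run false 0 true ⊕ run true j Y
adjacentReply-shiftˡ X Y i (suc j') (inj₂ (_ , refl , g)) = inj₂ (_ , refl ,
  local-shift (run-periodic X (suc i + suc (suc j')) Y)
    (trans (cong (_⊕ rest) (run-periodic X (suc i) true)) (⊕-assoc oneFloor (run X (4 + i) true) rest)) g)
  where rest = run true 0 false ⊕ run false j' Y

run-periodicʳ : ∀ X Y i j → run X (i + suc (9 + j)) Y ≡ oneFloor ⊕ run X (i + suc (4 + j)) Y
run-periodicʳ X Y i j = trans (cong (λ n → run X n Y) (+-five i (suc (4 + j))))
  (run-periodic-≥3 X Y (≤-trans (s≤s (s≤s (s≤s z≤n))) (m≤n+m (suc (4 + j)) i)))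
  where
  +-five : ∀ i n → i + (5 + n) ≡ 5 + (i + n)
  +-five = solve-∀

adjacentReply-shiftʳ : ∀ X Y i j → AdjacentReply X Y i (4 + j) → AdjacentReply X Y i (9 + j)
adjacentReply-shiftʳ X Y (suc i') j (inj₁ (_ , refl , g)) = inj₁ (i' , refl ,
  local-shift (run-periodicʳ X Y (suc i') j)
    (trans (cong (λ r → run X i' false ⊕ run false 0 true ⊕ r) (run-periodic true (suc j) Y))
           (⊕-pullˡ (run X i' false) (run false 0 true) (run true (4 + j) Y))) g)
adjacentReply-shiftʳ X Y i j (inj₂ (_ , refl , g)) = inj₂ (_ , refl ,
  local-shift (run-periodicʳ X Y i j)
    (trans (cong (λ r → run X i true ⊕ run true 0 false ⊕ r) (run-periodic false j Y))
           (⊕-pullˡ (run X i true) (run true 0 false) (run false (3 + j) Y))) g)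

adjacentReply : ∀ X Y i j → 1 ≤ i + j → AdjacentReply X Y i j
adjacentReply X Y = periodic 4 (λ i → ∀ j → 1 ≤ i + j → AdjacentReply X Y i j)
  (λ m r j _ → adjacentReply-shiftˡ X Y m j (r j (s≤s z≤n)))
  (λ {i} i<9 → periodic 4 (λ j → 1 ≤ i + j → AdjacentReply X Y i j)
    (λ m r _ → adjacentReply-shiftʳ X Y i m (r (≤-trans (s≤s z≤n) (m≤n+m (4 + m) i))))
    (λ {j} j<9 pos → adjacentReply?-sound X Y i j
      (nonzero (leftReply? X Y i j) (rightReply? X Y i j) pos (all-upTo (λ j → reply? X Y i j)
        (all-upTo (λ i → all (λ j → reply? X Y i j) (upTo 9)) (small X Y) i<9) j<9))))
  where
  reply? : Bool → Bool → ℕ → ℕ → Bool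
  reply? X Y i j = (i + j ≡ᵇ 0) ∨ leftReply? X Y i j ∨ rightReply? X Y i j
  nonzero : ∀ {n} a b → 1 ≤ n → T ((n ≡ᵇ 0) ∨ a ∨ b) → T a ⊎ T b
  nonzero true  b (s≤s _) _  = inj₁ tt
  nonzero false b (s≤s _) ok = inj₂ ok
  small : ∀ X Y → T (all (λ i → all (λ j → reply? X Y i j) (upTo 9)) (upTo 9))
  small false false = tt
  small false true  = tt
  small true  false = tt
  small true  true  = tt

Claimed : Cell → Set
Claimed free    = ⊥
Claimed maker   = ⊤
Claimed breaker = ⊤

frees : ℕ → List Cell
frees n = replicate n free

frees-+ : ∀ u v W → frees (u + suc v) ++ W ≡ frees u ++ free ∷ frees v ++ W
frees-+ zero    v W = refl
frees-+ (suc u) v W = cong (free ∷_) (frees-+ u v W)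

frees-snoc : ∀ n W → frees (suc n) ++ W ≡ frees n ++ free ∷ W
frees-snoc zero    W = refl
frees-snoc (suc n) W = cong (free ∷_) (frees-snoc n W)

claimC-claimed : ∀ o y Z → Claimed y → claimC o (y ∷ Z) ≡ map (y ∷_) (claimC o Z)
claimC-claimed o maker   Z _ = refl
claimC-claimed o breaker Z _ = refl

map-cons-snoc : ∀ c r (xs : List (List Cell)) →
  map (c ∷_) (map (_++ r ∷ []) xs) ≡ map (_++ r ∷ []) (map (c ∷_) xs)
map-cons-snoc c r xs = trans (sym (map-∘ xs)) (map-∘ xs)

claimC-snoc : ∀ o cs r → Claimed r → claimC o (cs ++ r ∷ []) ≡ map (_++ r ∷ []) (claimC o cs)
claimC-snoc o []             maker   _  = refl
claimC-snoc o []             breaker _  = refl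
claimC-snoc o (free ∷ cs)    r       cr = cong ((o ∷ cs ++ r ∷ []) ∷_)
  (trans (cong (map (free ∷_)) (claimC-snoc o cs r cr)) (map-cons-snoc free r (claimC o cs)))
claimC-snoc o (maker ∷ cs)   r       cr =
  trans (cong (map (maker ∷_)) (claimC-snoc o cs r cr)) (map-cons-snoc maker r (claimC o cs))
claimC-snoc o (breaker ∷ cs) r       cr =
  trans (cong (map (breaker ∷_)) (claimC-snoc o cs r cr)) (map-cons-snoc breaker r (claimC o cs))

Any-claimC-∷ : ∀ {P : List Cell → Set} o c W →
  Any (λ W' → P (c ∷ W')) (claimC o W) → Any P (claimC o (c ∷ W))
Any-claimC-∷ o free    W a = there (Any.map⁺ a)
Any-claimC-∷ o maker   W a = Any.map⁺ a
Any-claimC-∷ o breaker W a = Any.map⁺ a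

Any-claimC-++ : ∀ {P : List Cell → Set} o U Z →
  Any (λ W' → P (U ++ W')) (claimC o Z) → Any P (claimC o (U ++ Z))
Any-claimC-++ o []      Z a = a
Any-claimC-++ o (c ∷ U) Z a = Any-claimC-∷ o c (U ++ Z) (Any-claimC-++ o U Z a)

All-claimC-frees : ∀ {P : List Cell → Set} o n Z →
  (∀ i j → i + suc j ≡ n → P (frees i ++ o ∷ frees j ++ Z)) →
  All (λ W' → P (frees n ++ W')) (claimC o Z) → All P (claimC o (frees n ++ Z))
All-claimC-frees o zero    Z inFrees behind = behind
All-claimC-frees o (suc n) Z inFrees behind = inFrees 0 n refl ∷ All.map⁺
  (All-claimC-frees o n Z (λ i j e → inFrees (suc i) j (cong suc e)) behind)

runBetween : Cell → ℕ → Cell → Profile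
runBetween p n y = run (isMaker p) n (isMaker y)

-- runsFrom p n W: the runs of W, the first of which continues n free cells
-- that follow the claimed cell p.
runsFrom : Cell → ℕ → List Cell → Profile
runsFrom p n []            = 𝟘
runsFrom p n (free ∷ W)    = runsFrom p (suc n) W
runsFrom p n (maker ∷ W)   = runBetween p n maker ⊕ runsFrom maker 0 W
runsFrom p n (breaker ∷ W) = runBetween p n breaker ⊕ runsFrom breaker 0 W

runsFrom-frees : ∀ p n m W → runsFrom p n (frees m ++ W) ≡ runsFrom p (m + n) W
runsFrom-frees p n zero    W = refl
runsFrom-frees p n (suc m) W =
  trans (runsFrom-frees p (suc n) m W) (cong (λ k → runsFrom p k W) (+-suc m n))

runsFrom-split : ∀ p n y Z → Claimed y →
  runsFrom p 0 (frees n ++ y ∷ Z) ≡ runBetween p n y ⊕ runsFrom y 0 Z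
runsFrom-split p n y Z cy = trans (runsFrom-frees p 0 n (y ∷ Z))
  (trans (cong (λ k → runsFrom p k (y ∷ Z)) (+-identityʳ n)) (claimed y cy))
  where
  claimed : ∀ y → Claimed y → runsFrom p n (y ∷ Z) ≡ runBetween p n y ⊕ runsFrom y 0 Z
  claimed maker   _ = refl
  claimed breaker _ = refl

runsFrom-split₂ : ∀ p u x v y Z → Claimed x → Claimed y →
  runsFrom p 0 (frees u ++ x ∷ frees v ++ y ∷ Z) ≡ runBetween p u x ⊕ runBetween x v y ⊕ runsFrom y 0 Z
runsFrom-split₂ p u x v y Z cx cy = trans (runsFrom-split p u x (frees v ++ y ∷ Z) cx)
  (cong (runBetween p u x ⊕_) (runsFrom-split x v y Z cy))

runsFrom-split₃ : ∀ p a x b z c y Z → Claimed x → Claimed z → Claimed y →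
  runsFrom p 0 (frees a ++ x ∷ frees b ++ z ∷ frees c ++ y ∷ Z)
    ≡ runBetween p a x ⊕ runBetween x b z ⊕ runBetween z c y ⊕ runsFrom y 0 Z
runsFrom-split₃ p a x b z c y Z cx cz cy =
  trans (runsFrom-split p a x _ cx) (cong (runBetween p a x ⊕_) (runsFrom-split₂ x b z c y Z cz cy))

board-ind : (Q : Cell → List Cell → Set) → (∀ y → Q y []) →
  (∀ p n y Z → Claimed y → Q y Z → Q p (frees n ++ y ∷ Z)) →
  ∀ p cs r → Claimed r → Q p (cs ++ r ∷ [])
board-ind Q base step p cs r cr = go p 0 cs
  where
  go : ∀ p n cs → Q p (frees n ++ cs ++ r ∷ [])
  go p n []             = step p n r [] cr (base r)
  go p n (free ∷ cs)    = subst (Q p) (frees-snoc n (cs ++ r ∷ [])) (go p (suc n) cs)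
  go p n (maker ∷ cs)   = step p n maker (cs ++ r ∷ []) tt (go maker 0 cs)
  go p n (breaker ∷ cs) = step p n breaker (cs ++ r ∷ []) tt (go breaker 0 cs)

BoardReply : (Profile → Profile → Set) → Profile → Cell → List Cell → Set
BoardReply R d p W = Any (λ W' → R d (runsFrom p 0 W')) (claimC breaker W)

boardReply-behind : ∀ {R} → ContextClosed R → ∀ p n y Z M → Claimed y →
  BoardReply R (runsFrom y 0 Z) y M →
  BoardReply R (runsFrom p 0 (frees n ++ y ∷ Z)) p (frees n ++ y ∷ M)
boardReply-behind {R} closed p n y Z M cy a = Any-claimC-++ breaker (frees n) (y ∷ M)
  (subst (Any _) (sym (claimC-claimed breaker y M cy)) (Any.map⁺ (Any.map (λ {W'} r →
    subst₂ R (sym (runsFrom-split p n y Z cy)) (sym (runsFrom-split p n y W' cy))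
      (closed (runBetween p n y) r)) a)))

boardReply-split : ∀ {R} → ContextClosed R → ∀ p u v y Z → Claimed y →
  R (runBetween p (u + suc v) y) (runBetween p u breaker ⊕ runBetween breaker v y) →
  BoardReply R (runsFrom p 0 (frees (u + suc v) ++ y ∷ Z)) p (frees (u + suc v) ++ y ∷ Z)
boardReply-split {R} closed p u v y Z cy r =
  subst (λ W → Any (λ W' → R d (runsFrom p 0 W')) (claimC breaker W)) (sym (frees-+ u v (y ∷ Z)))
    (Any-claimC-++ breaker (frees u) (free ∷ frees v ++ y ∷ Z) (here
      (subst₂ R (sym (runsFrom-split p (u + suc v) y Z cy))
        (trans (⊕-assoc (runBetween p u breaker) (runBetween breaker v y) E)
               (sym (runsFrom-split₂ p u breaker v y Z tt cy)))
        (closed-⊕ʳ closed E r))))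
  where
  d = runsFrom p 0 (frees (u + suc v) ++ y ∷ Z)
  E = runsFrom y 0 Z

⊕-assoc₃ : ∀ a b c e → (a ⊕ b ⊕ c) ⊕ e ≡ a ⊕ b ⊕ c ⊕ e
⊕-assoc₃ a b c e = trans (⊕-assoc a (b ⊕ c) e) (cong (a ⊕_) (⊕-assoc b c e))

boardReply-adjacent : ∀ p y Z i j → Claimed y → AdjacentReply (isMaker p) (isMaker y) i j →
  BoardReply (Local false) (runsFrom p 0 (frees (i + suc j) ++ y ∷ Z))
             p (frees i ++ maker ∷ frees j ++ y ∷ Z)
boardReply-adjacent p y Z (suc i') j cy (inj₁ (_ , refl , g)) =
  subst (λ W → Any (λ W' → Local false d (runsFrom p 0 W')) (claimC breaker W))
    (sym (frees-snoc i' (maker ∷ frees j ++ y ∷ Z)))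
    (Any-claimC-++ breaker (frees i') (free ∷ maker ∷ frees j ++ y ∷ Z) (here
      (subst₂ (Local false) (sym (runsFrom-split p (suc i' + suc j) y Z cy))
        (trans (⊕-assoc₃ (runBetween p i' breaker) (runBetween breaker 0 maker) (runBetween maker j y) E)
               (sym (runsFrom-split₃ p i' breaker 0 maker j y Z tt tt cy)))
        (closed-⊕ʳ local-⊕ˡ E g))))
  where
  d = runsFrom p 0 (frees (suc i' + suc j) ++ y ∷ Z)
  E = runsFrom y 0 Z
boardReply-adjacent p y Z i (suc j') cy (inj₂ (_ , refl , g)) =
  Any-claimC-++ breaker (frees i) (maker ∷ free ∷ frees j' ++ y ∷ Z)
    (Any-claimC-∷ breaker maker (free ∷ frees j' ++ y ∷ Z) (here
      (subst₂ (Local false) (sym (runsFrom-split p (i + suc (suc j')) y Z cy))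
        (trans (⊕-assoc₃ (runBetween p i maker) (runBetween maker 0 breaker) (runBetween breaker j' y) E)
               (sym (runsFrom-split₃ p i maker 0 breaker j' y Z tt tt cy)))
        (closed-⊕ʳ local-⊕ˡ E g))))
  where E = runsFrom y 0 Z

-- Maker has claimed the only cell of a run.
Fill : Profile → Profile → Set
Fill d d' =
  ∃ λ X → ∃ λ Y → ∃ λ E → d ≡ run X 1 Y ⊕ E × d' ≡ run X 0 true ⊕ run true 0 Y ⊕ E

fill-closed : ContextClosed Fill
fill-closed e (X , Y , E , refl , refl) =
  X , Y , e ⊕ E , ⊕-swap e (run X 1 Y) E ,
  trans (⊕-swap e (run X 0 true) _) (cong (run X 0 true ⊕_) (⊕-swap e (run true 0 Y) E))

BoardAnswer : Profile → Cell → List Cell → Set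
BoardAnswer d p M = BoardReply (Local false) d p M ⊎ Fill d (runsFrom p 0 M)

boardAnswer-run : ∀ p y Z i j → Claimed y →
  BoardAnswer (runsFrom p 0 (frees (i + suc j) ++ y ∷ Z)) p (frees i ++ maker ∷ frees j ++ y ∷ Z)
boardAnswer-run p y Z zero zero cy = inj₂ (isMaker p , isMaker y , runsFrom y 0 Z ,
  runsFrom-split p 1 y Z cy , runsFrom-split₂ p 0 maker 0 y Z tt cy)
boardAnswer-run p y Z (suc i) j cy =
  inj₁ (boardReply-adjacent p y Z (suc i) j cy (adjacentReply _ _ (suc i) j (s≤s z≤n)))
boardAnswer-run p y Z zero (suc j) cy =
  inj₁ (boardReply-adjacent p y Z zero (suc j) cy (adjacentReply _ _ zero (suc j) (s≤s z≤n)))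

boardAnswer-behind : ∀ p n y Z M → Claimed y → BoardAnswer (runsFrom y 0 Z) y M →
  BoardAnswer (runsFrom p 0 (frees n ++ y ∷ Z)) p (frees n ++ y ∷ M)
boardAnswer-behind p n y Z M cy (inj₁ a) = inj₁ (boardReply-behind local-⊕ˡ p n y Z M cy a)
boardAnswer-behind p n y Z M cy (inj₂ f) = inj₂ (subst₂ Fill (sym (runsFrom-split p n y Z cy))
  (sym (runsFrom-split p n y M cy)) (fill-closed (runBetween p n y) f))

boardAnswers : ∀ p cs r → Claimed r →
  All (BoardAnswer (runsFrom p 0 (cs ++ r ∷ [])) p) (claimC maker (cs ++ r ∷ []))
boardAnswers = board-ind (λ p W → All (BoardAnswer (runsFrom p 0 W) p) (claimC maker W)) (λ _ → [])
  (λ p n y Z cy rest → All-claimC-frees maker n (y ∷ Z)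
    (λ i j e → subst (λ k → BoardAnswer (runsFrom p 0 (frees k ++ y ∷ Z)) p
                                          (frees i ++ maker ∷ frees j ++ y ∷ Z))
                     e (boardAnswer-run p y Z i j cy))
    (subst (All _) (sym (claimC-claimed maker y Z cy))
      (All.map⁺ (All.map (λ {M} → boardAnswer-behind p n y Z M cy) rest))))

NoMoves : {A : Set} → List A → Set
NoMoves = All (λ _ → ⊥)

data BreakerMove {A : Set} (prof : A → Profile) (d : Profile) (Ms : List A) : Set where
  strict : Any (λ M → Local true d (prof M)) Ms → BreakerMove prof d Ms
  weak   : floors d ≡ 0 → Any (λ M → Local false d (prof M)) Ms → BreakerMove prof d Ms
  stuck  : floors d ≡ 0 → NoMoves Ms → BreakerMove prof d Ms

BoardMove : Cell → List Cell → Set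
BoardMove p W = BreakerMove (runsFrom p 0) (runsFrom p 0 W) (claimC breaker W)

boardReply-splitting : ∀ {s} p n y Z → Claimed y → Split s (isMaker p) (isMaker y) n →
  BoardReply (Local s) (runsFrom p 0 (frees n ++ y ∷ Z)) p (frees n ++ y ∷ Z)
boardReply-splitting p _ y Z cy (u , v , refl , g) = boardReply-split local-⊕ˡ p u v y Z cy g

floors-split : ∀ p n y Z → Claimed y →
  floors (runBetween p n y) ≡ 0 → floors (runsFrom y 0 Z) ≡ 0 → floors (runsFrom p 0 (frees n ++ y ∷ Z)) ≡ 0
floors-split p n y Z cy f₁ f₂ = trans (cong floors (runsFrom-split p n y Z cy)) (cong₂ _+_ f₁ f₂)

boardMove-step : ∀ p n y Z → Claimed y → BoardMove y Z → BoardMove p (frees n ++ y ∷ Z)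
boardMove-step p n@(suc m) y Z cy rest = longRun (breakerSplit (isMaker p) (isMaker y) m) rest
  where
  within : ∀ {s} → Split s (isMaker p) (isMaker y) n →
    BoardReply (Local s) (runsFrom p 0 (frees n ++ y ∷ Z)) p (frees n ++ y ∷ Z)
  within = boardReply-splitting p n y Z cy
  longRun : RunSplit (isMaker p) (isMaker y) n → BoardMove y Z → BoardMove p (frees n ++ y ∷ Z)
  longRun (inj₁ sp)       _            = strict (within sp)
  longRun (inj₂ (_ , sp)) (strict a)   = strict (boardReply-behind local-⊕ˡ p n y Z Z cy a)
  longRun (inj₂ (f , sp)) (weak f′ _)  = weak (floors-split p n y Z cy f f′) (within sp)
  longRun (inj₂ (f , sp)) (stuck f′ _) = weak (floors-split p n y Z cy f f′) (within sp)
boardMove-step p zero y Z cy (strict a)   = strict (boardReply-behind local-⊕ˡ p 0 y Z Z cy a)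
boardMove-step p zero y Z cy (weak f a)   =
  weak (floors-split p 0 y Z cy refl f) (boardReply-behind local-⊕ˡ p 0 y Z Z cy a)
boardMove-step p zero y Z cy (stuck f nm) =
  stuck (floors-split p 0 y Z cy refl f) (subst NoMoves (sym (claimC-claimed breaker y Z cy)) (All.map⁺ nm))

boardMoves : ∀ p cs r → Claimed r → BoardMove p (cs ++ r ∷ [])
boardMoves = board-ind BoardMove (λ _ → stuck refl []) boardMove-step

single : Profile
single = run true 1 true

-- Breaker claims the only cell of a run H(1).
FillsSingle : Profile → Profile → Set
FillsSingle d d' = d ≡ single ⊕ d'

fillsSingle-closed : ContextClosed FillsSingle
fillsSingle-closed e {d' = d'} eq = trans (cong (e ⊕_) eq) (⊕-swap e single d')

n₅-run : ∀ X n Y → n₅ (run X n Y) ≡ 0 ⊎ (X ≡ true × n ≡ 1 × Y ≡ true)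
n₅-run X     zero          Y     = inj₁ refl
n₅-run false (suc n)       false = inj₁ refl
n₅-run false (suc n)       true  = inj₁ refl
n₅-run true  (suc n)       false = inj₁ refl
n₅-run true  (suc zero)    true  = inj₂ (refl , refl , refl)
n₅-run true  (suc (suc n)) true  = inj₁ refl

isMaker-true : ∀ p → isMaker p ≡ true → p ≡ maker
isMaker-true maker _ = refl

BoardSingle : Cell → List Cell → Set
BoardSingle p W = n₅ (runsFrom p 0 W) ≡ 0 ⊎ BoardReply FillsSingle (runsFrom p 0 W) p W

boardSingle-step : ∀ p n y Z → Claimed y → BoardSingle y Z → BoardSingle p (frees n ++ y ∷ Z)
boardSingle-step p n y Z cy rest with n₅-run (isMaker p) n (isMaker y)
... | inj₂ (pm , refl , ym) with isMaker-true p pm | isMaker-true y ym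
...   | refl | refl = inj₂ (here refl)
boardSingle-step p n y Z cy (inj₁ z) | inj₁ z₀ =
  inj₁ (trans (cong n₅ (runsFrom-split p n y Z cy)) (cong₂ _+_ z₀ z))
boardSingle-step p n y Z cy (inj₂ a) | inj₁ _ = inj₂ (boardReply-behind fillsSingle-closed p n y Z Z cy a)

boardSingles : ∀ p cs r → Claimed r → BoardSingle p (cs ++ r ∷ [])
boardSingles = board-ind BoardSingle (λ _ → inj₁ refl) boardSingle-step

-- The ends of a board act as claimed cells: Maker's where the score of G and H
-- counts the pairs {0,1} and {n,n+1}, Breaker's otherwise.
leftEnd rightEnd : Kind → Cell
leftEnd KF = breaker
leftEnd KG = maker
leftEnd KH = maker
rightEnd KF = breaker
rightEnd KG = breaker
rightEnd KH = maker

rightEnd-claimed : ∀ k → Claimed (rightEnd k)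
rightEnd-claimed KF = tt
rightEnd-claimed KG = tt
rightEnd-claimed KH = tt

componentProfile : Component → Profile
componentProfile (k , cs) = runsFrom (leftEnd k) 0 (cs ++ rightEnd k ∷ [])

profile : Position → Profile
profile []      = 𝟘
profile (c ∷ P) = componentProfile c ⊕ profile P

claimC-board : ∀ o k cs → claimC o (cs ++ rightEnd k ∷ []) ≡ map (_++ rightEnd k ∷ []) (claimC o cs)
claimC-board o k cs = claimC-snoc o cs (rightEnd k) (rightEnd-claimed k)

Reply : (Profile → Profile → Set) → Profile → Position → Set
Reply R d q = Any (λ q' → R d (profile q')) (claimP breaker q)

reply-here : ∀ {R} → ContextClosed R → ∀ k cs P {d} →
  BoardReply R d (leftEnd k) (cs ++ rightEnd k ∷ []) → Reply R (d ⊕ profile P) ((k , cs) ∷ P)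
reply-here closed k cs P a = Any.++⁺ˡ (Any.map⁺
  (Any.map (closed-⊕ʳ closed (profile P)) (Any.map⁻ (subst (Any _) (claimC-board breaker k cs) a))))

reply-later : ∀ {R} → ContextClosed R → ∀ c P {d} →
  Reply R d P → Reply R (componentProfile c ⊕ d) (c ∷ P)
reply-later closed (k , cs) P a = Any.++⁺ʳ _ (Any.map⁺ (Any.map (closed (componentProfile (k , cs))) a))

noMoves-++ : ∀ k cs P → NoMoves (claimC breaker (cs ++ rightEnd k ∷ [])) → NoMoves (claimP breaker P) →
  NoMoves (claimP breaker ((k , cs) ∷ P))
noMoves-++ k cs P none₁ none₂ =
  All.++⁺ (All.map⁺ (All.map⁻ (subst NoMoves (claimC-board breaker k cs) none₁))) (All.map⁺ none₂)

Answer : Profile → Position → Set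
Answer d q = Reply (Local false) d q ⊎ Fill d (profile q)

positionAnswers : ∀ P → All (Answer (profile P)) (claimP maker P)
positionAnswers [] = []
positionAnswers ((k , cs) ∷ P) = All.++⁺
  (All.map⁺ (All.map (λ {c} → inComponent c) (All.map⁻ (subst (All _) (claimC-board maker k cs)
    (boardAnswers (leftEnd k) cs (rightEnd k) (rightEnd-claimed k))))))
  (All.map⁺ (All.map (λ {q} → elsewhere q) (positionAnswers P)))
  where
  dC = componentProfile (k , cs)
  inComponent : ∀ c → BoardAnswer dC (leftEnd k) (c ++ rightEnd k ∷ []) →
                Answer (dC ⊕ profile P) ((k , c) ∷ P)
  inComponent c (inj₁ a) = inj₁ (reply-here local-⊕ˡ k c P a)
  inComponent c (inj₂ f) = inj₂ (closed-⊕ʳ fill-closed (profile P) f)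
  elsewhere : ∀ q → Answer (profile P) q → Answer (dC ⊕ profile P) ((k , cs) ∷ q)
  elsewhere q (inj₁ a) = inj₁ (reply-later local-⊕ˡ (k , cs) q a)
  elsewhere q (inj₂ f) = inj₂ (fill-closed dC f)

PositionMove : Position → Set
PositionMove P = BreakerMove profile (profile P) (claimP breaker P)

positionMove : ∀ P → PositionMove P
positionMove [] = stuck refl []
positionMove ((k , cs) ∷ P) =
  merge (boardMoves (leftEnd k) cs (rightEnd k) (rightEnd-claimed k)) (positionMove P)
  where
  merge : BoardMove (leftEnd k) (cs ++ rightEnd k ∷ []) → PositionMove P → PositionMove ((k , cs) ∷ P)
  merge (strict a)  _           = strict (reply-here local-⊕ˡ k cs P a)
  merge (weak _ _)  (strict a)  = strict (reply-later local-⊕ˡ (k , cs) P a)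
  merge (stuck _ _) (strict a)  = strict (reply-later local-⊕ˡ (k , cs) P a)
  merge (weak f a)  (weak f′ _)  = weak (cong₂ _+_ f f′) (reply-here local-⊕ˡ k cs P a)
  merge (weak f a)  (stuck f′ _) = weak (cong₂ _+_ f f′) (reply-here local-⊕ˡ k cs P a)
  merge (stuck f _) (weak f′ a)  = weak (cong₂ _+_ f f′) (reply-later local-⊕ˡ (k , cs) P a)
  merge (stuck f n) (stuck f′ n′) = stuck (cong₂ _+_ f f′) (noMoves-++ k cs P n n′)

positionSingle : ∀ P → n₅ (profile P) ≡ 0 ⊎ Reply FillsSingle (profile P) P
positionSingle [] = inj₁ refl
positionSingle ((k , cs) ∷ P)
  with boardSingles (leftEnd k) cs (rightEnd k) (rightEnd-claimed k) | positionSingle P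
... | inj₂ a | _      = inj₂ (reply-here fillsSingle-closed k cs P a)
... | inj₁ _ | inj₂ a = inj₂ (reply-later fillsSingle-closed (k , cs) P a)
... | inj₁ z | inj₁ z′ = inj₁ (cong₂ _+_ z z′)

runsFrom-balanced : ∀ p n W → Balanced (runsFrom p n W)
runsFrom-balanced p n []            = z≤n
runsFrom-balanced p n (free ∷ W)    = runsFrom-balanced p (suc n) W
runsFrom-balanced p n (maker ∷ W)   = balanced-⊕ (runBetween p n maker) (runsFrom maker 0 W)
  (run-balanced (isMaker p) true n) (runsFrom-balanced maker 0 W)
runsFrom-balanced p n (breaker ∷ W) = balanced-⊕ (runBetween p n breaker) (runsFrom breaker 0 W)
  (run-balanced (isMaker p) false n) (runsFrom-balanced breaker 0 W)

profile-balanced : ∀ P → Balanced (profile P)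
profile-balanced []            = z≤n
profile-balanced ((k , cs) ∷ P) = balanced-⊕ (componentProfile (k , cs)) (profile P)
  (runsFrom-balanced (leftEnd k) 0 (cs ++ rightEnd k ∷ [])) (profile-balanced P)

balanced-≼ : ∀ d → Balanced d → made d ≼ d
balanced-≼ d b = begin
  made d + (n₄ d + ⌊ n₁₂₃ d + n₅ d % 2 /2⌋)
    ≤⟨ +-monoʳ-≤ (made d) (+-monoʳ-≤ (n₄ d) (⌊n/2⌋≤n _)) ⟩
  made d + (n₄ d + (n₁₂₃ d + n₅ d % 2))
    ≡⟨ shuffle (made d) (n₄ d) (n₁₂₃ d) (n₅ d % 2) ⟩
  made d + (n₁₂₃ d + n₄ d) + n₅ d % 2
    ≤⟨ +-monoˡ-≤ (n₅ d % 2) (+-monoʳ-≤ (made d) (≤-trans (m≤m+n _ (n₅ d)) b)) ⟩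
  credit d ∎
  where
  open ≤-Reasoning
  shuffle : ∀ c q k e → c + (q + (k + e)) ≡ c + (k + q) + e
  shuffle = solve-∀

parityDefect-zero : ∀ d → Balanced d → floors d ≡ 0 → parityDefect d ≡ 0
parityDefect-zero d b f = cong₂ (λ k p → (k + p % 2) % 2)
  (m+n≡0⇒m≡0 (n₁₂₃ d) (m+n≡0⇒m≡0 (n₁₂₃ d + n₄ d) none))
  (m+n≡0⇒n≡0 (n₁₂₃ d + n₄ d) none)
  where
  none : n₁₂₃ d + n₄ d + n₅ d ≡ 0
  none = n≤0⇒n≡0 (subst (n₁₂₃ d + n₄ d + n₅ d ≤_) f b)

made-run-suc : ∀ X n Y → made (run X (suc n) Y) ≡ 0
made-run-suc false n false = refl
made-run-suc false n true  = refl
made-run-suc true  n false = refl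
made-run-suc true  n true  = refl

lastCell : Cell → ℕ → Cell
lastCell p zero    = p
lastCell p (suc n) = free

made-runsFrom : ∀ p n W → made (runsFrom p n W) ≡ adj (lastCell p n ∷ W)
made-runsFrom p n       []            = refl
made-runsFrom p n       (free ∷ W)    = trans (made-runsFrom p (suc n) W) (sym (no-pair (lastCell p n)))
  where
  no-pair : ∀ c → adj (c ∷ free ∷ W) ≡ adj (free ∷ W)
  no-pair free    = refl
  no-pair maker   = refl
  no-pair breaker = refl
made-runsFrom p zero    (maker ∷ W)   = cong (made (runBetween p 0 maker) +_) (made-runsFrom maker 0 W)
made-runsFrom p zero    (breaker ∷ W) = cong (made (runBetween p 0 breaker) +_) (made-runsFrom breaker 0 W)
made-runsFrom p (suc n) (maker ∷ W)   =
  cong₂ _+_ (made-run-suc (isMaker p) n true) (made-runsFrom maker 0 W)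
made-runsFrom p (suc n) (breaker ∷ W) =
  cong₂ _+_ (made-run-suc (isMaker p) n false) (made-runsFrom breaker 0 W)

adj-breaker : ∀ W → adj (breaker ∷ W) ≡ adj W
adj-breaker []      = refl
adj-breaker (x ∷ W) = refl

adj-snoc-breaker : ∀ cs → adj (cs ++ breaker ∷ []) ≡ adj cs
adj-snoc-breaker []              = refl
adj-snoc-breaker (free ∷ [])    = refl
adj-snoc-breaker (maker ∷ [])   = refl
adj-snoc-breaker (breaker ∷ []) = refl
adj-snoc-breaker (x ∷ y ∷ cs)    =
  cong ((if isMaker x ∧ isMaker y then 1 else 0) +_) (adj-snoc-breaker (y ∷ cs))

componentScore-profile : ∀ c → componentScore c ≡ made (componentProfile c)
componentScore-profile (KF , cs) = sym (trans (made-runsFrom breaker 0 (cs ++ breaker ∷ []))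
  (trans (adj-breaker (cs ++ breaker ∷ [])) (adj-snoc-breaker cs)))
componentScore-profile (KG , cs) =
  sym (trans (made-runsFrom maker 0 (cs ++ breaker ∷ [])) (adj-snoc-breaker (maker ∷ cs)))
componentScore-profile (KH , cs) = sym (made-runsFrom maker 0 (cs ++ maker ∷ []))

score-profile : ∀ P → score P ≡ made (profile P)
score-profile []      = refl
score-profile (c ∷ P) = cong₂ _+_ (componentScore-profile c) (score-profile P)

adj-isMaker : ∀ W W' → map isMaker W ≡ map isMaker W' → adj W ≡ adj W'
adj-isMaker []           []             _ = refl
adj-isMaker (x ∷ [])     (x' ∷ [])      _ = refl
adj-isMaker (x ∷ y ∷ W)  (x' ∷ y' ∷ W') e = cong₂ _+_
  (cong₂ (λ a b → if a ∧ b then 1 else 0) (∷-injectiveˡ e) (∷-injectiveˡ (∷-injectiveʳ e)))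
  (adj-isMaker (y ∷ W) (y' ∷ W') (∷-injectiveʳ e))
adj-isMaker []           (_ ∷ _)        ()
adj-isMaker (_ ∷ _)      []             ()
adj-isMaker (_ ∷ [])     (_ ∷ _ ∷ _)    ()
adj-isMaker (_ ∷ _ ∷ _)  (_ ∷ [])       ()

claimC-breaker-isMaker : ∀ W → All (λ W' → map isMaker W' ≡ map isMaker W) (claimC breaker W)
claimC-breaker-isMaker []            = []
claimC-breaker-isMaker (free ∷ W)    =
  refl ∷ All.map⁺ (All.map (cong (false ∷_)) (claimC-breaker-isMaker W))
claimC-breaker-isMaker (maker ∷ W)   = All.map⁺ (All.map (cong (true ∷_)) (claimC-breaker-isMaker W))
claimC-breaker-isMaker (breaker ∷ W) = All.map⁺ (All.map (cong (false ∷_)) (claimC-breaker-isMaker W))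

componentScore-isMaker : ∀ k cs cs' →
  map isMaker cs' ≡ map isMaker cs → componentScore (k , cs') ≡ componentScore (k , cs)
componentScore-isMaker KF cs cs' e = adj-isMaker cs' cs e
componentScore-isMaker KG cs cs' e = adj-isMaker (maker ∷ cs') (maker ∷ cs) (cong (true ∷_) e)
componentScore-isMaker KH cs cs' e = adj-isMaker (maker ∷ cs' ++ maker ∷ []) (maker ∷ cs ++ maker ∷ [])
  (cong (true ∷_) (trans (map-++ isMaker cs' _) (trans (cong (_++ true ∷ []) e) (sym (map-++ isMaker cs _)))))

score-claimP-breaker : ∀ q → All (λ q' → score q' ≡ score q) (claimP breaker q)
score-claimP-breaker []             = []
score-claimP-breaker ((k , cs) ∷ P) = All.++⁺
  (All.map⁺ (All.map (λ {cs'} e → cong (_+ score P) (componentScore-isMaker k cs cs' e))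
                     (claimC-breaker-isMaker cs)))
  (All.map⁺ (All.map (cong (componentScore (k , cs) +_)) (score-claimP-breaker P)))

-- What Breaker secures on his turn in the position of profile d', measured
-- against the profile d before Maker's last move.
Result : {A : Set} → (A → Profile) → Profile → Profile → List A → Set
Result prof d d' Ms = Any (λ M → Descent false d (prof M)) Ms ⊎ (NoMoves Ms × made d' ≼ d)

⌊/2⌋-suc : ∀ x → ⌊ suc x /2⌋ ≡ ⌊ x /2⌋ + x % 2
⌊/2⌋-suc zero          = refl
⌊/2⌋-suc (suc zero)    = refl
⌊/2⌋-suc (suc (suc x)) = cong suc (⌊/2⌋-suc x)

even⇒suc-odd : ∀ n → n % 2 ≡ 0 → suc n % 2 ≡ 1
even⇒suc-odd zero          _ = refl
even⇒suc-odd (suc (suc n)) e = even⇒suc-odd n e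

descent-transfer : ∀ d d' d'' → credit d ≡ credit d' → debit d ≡ debit d' + parityDefect d' →
  Descent true d' d'' → Descent false d d''
descent-transfer d d' d'' c≡ d≡ h rewrite c≡ | d≡ =
  subst (_≤ credit d' + debit d'') (sym (trans (+-identityʳ _) (sym (+-assoc (credit d'') (debit d') _)))) h

descent-strengthen : ∀ d d' → parityDefect d ≡ 0 → Descent false d d' → Descent true d d'
descent-strengthen d d' pd≡0 h rewrite pd≡0 = h

result-transfer : ∀ {A} {prof : A → Profile} {Ms} d d' → credit d ≡ credit d' →
  debit d ≡ debit d' + parityDefect d' → Balanced d' → BreakerMove prof d' Ms → Result prof d d' Ms
result-transfer {prof = prof} d d' c≡ d≡ b (strict a) =
  inj₁ (Any.map (λ {M} g → descent-transfer d d' (prof M) c≡ d≡ (g 𝟘)) a)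
result-transfer {prof = prof} d d' c≡ d≡ b (weak f a) = inj₁ (Any.map (λ {M} g →
  descent-transfer d d' (prof M) c≡ d≡
    (descent-strengthen d' (prof M) (parityDefect-zero d' b f) (g 𝟘))) a)
result-transfer d d' c≡ d≡ b (stuck f none)
  rewrite c≡ | d≡ | parityDefect-zero d' b f | +-identityʳ (debit d') = inj₂ (none , balanced-≼ d' b)

result-same : ∀ {A} {prof : A → Profile} {Ms} d →
  Balanced d → BreakerMove prof d Ms → Result prof d d Ms
result-same {prof = prof} d b (strict a) = inj₁ (Any.map (λ {M} g → descent-weaken d (prof M) (g 𝟘)) a)
result-same d b (weak _ a)     = inj₁ (Any.map (λ g → g 𝟘) a)
result-same d b (stuck _ none) = inj₂ (none , balanced-≼ d b)

descent-afterSingle : ∀ E D →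
  run true 0 true ⊕ run true 0 true ⊕ E ≡ single ⊕ D → Descent false (single ⊕ E) D
descent-afterSingle ⟨ c , _ , k , _ , q ⟩ ⟨ _ , a , _ , p , _ ⟩ refl =
  ≤-reflexive (shuffle c a (p % 2) (q + ⌊ k + p % 2 /2⌋))
  where
  shuffle : ∀ c a P Q → 2 + c + a + P + Q + 0 ≡ c + (2 + a) + P + Q
  shuffle = solve-∀

fillG-credit : ∀ E → credit (run true 1 false ⊕ E) ≡ credit (run true 0 true ⊕ run true 0 false ⊕ E)
fillG-credit E = cong (_+ n₅ E % 2) (+-suc (made E) (floors E))

fillG-debit : ∀ E → debit (run true 1 false ⊕ E) ≡ debit E + parityDefect E
fillG-debit E = trans (cong (n₄ E +_) (⌊/2⌋-suc (n₁₂₃ E + n₅ E % 2))) (sym (+-assoc (n₄ E) _ _))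

fillH-credit : ∀ E → n₅ E % 2 ≡ 0 →
  credit (single ⊕ E) ≡ credit (run true 0 true ⊕ run true 0 true ⊕ E)
fillH-credit E even rewrite even⇒suc-odd (n₅ E) even | even = shuffle (made E) (floors E)
  where
  shuffle : ∀ c f → c + (1 + f) + 1 ≡ 2 + c + f + 0
  shuffle = solve-∀

fillH-debit : ∀ E → n₅ E % 2 ≡ 0 → debit (single ⊕ E) ≡ debit E + parityDefect E
fillH-debit E even
  rewrite even⇒suc-odd (n₅ E) even | even | +-identityʳ (n₁₂₃ E) | +-comm (n₁₂₃ E) 1 =
  trans (cong (n₄ E +_) (⌊/2⌋-suc (n₁₂₃ E))) (sym (+-assoc (n₄ E) _ _))

fillResult : ∀ {A} (prof : A → Profile) Ms X Y E {d'} → d' ≡ run X 0 true ⊕ run true 0 Y ⊕ E →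
  Balanced d' → BreakerMove prof d' Ms → n₅ d' ≡ 0 ⊎ Any (λ M → FillsSingle d' (prof M)) Ms →
  Result prof (run X 1 Y ⊕ E) d' Ms
fillResult prof Ms false false E refl b move _ = result-same (run false 0 true ⊕ run true 0 false ⊕ E) b move
fillResult prof Ms true  false E refl b move _ = result-transfer (run true 1 false ⊕ E)
  (run true 0 true ⊕ run true 0 false ⊕ E) (fillG-credit E) (fillG-debit E) b move
fillResult prof Ms false true  E refl b move _ = result-transfer (run true 1 false ⊕ E)
  (run true 0 true ⊕ run true 0 false ⊕ E) (fillG-credit E) (fillG-debit E) b move
fillResult prof Ms true  true  E refl b move singles with %2-cases (n₅ E) | singles
... | inj₁ even | _ = result-transfer (single ⊕ E)
  (run true 0 true ⊕ run true 0 true ⊕ E) (fillH-credit E even) (fillH-debit E even) b move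
... | inj₂ odd  | inj₁ none = ⊥-elim (0≢1+n (trans (sym (cong (_% 2) none)) odd))
... | inj₂ _    | inj₂ a = inj₁ (Any.map (λ {M} → descent-afterSingle E (prof M)) a)

Outcome : Profile → Position → Set
Outcome d q = Result profile d (profile q) (claimP breaker q)

outcome : ∀ P q → Answer (profile P) q → Outcome (profile P) q
outcome P q (inj₁ a) = inj₁ (Any.map (λ g → g 𝟘) a)
outcome P q (inj₂ (X , Y , E , e₁ , e₂)) = subst (λ d → Outcome d q) (sym e₁)
  (fillResult profile (claimP breaker q) X Y E e₂ (profile-balanced q) (positionMove q) (positionSingle q))

score-≼ : ∀ P → score P ≼ profile P
score-≼ P rewrite score-profile P = balanced-≼ (profile P) (profile-balanced P)

descent-≼ : ∀ x d d' → Descent false d d' → x ≼ d' → x ≼ d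
descent-≼ x d d' h hx = +-cancelʳ-≤ (debit d') (x + debit d) (credit d) (begin
  x + debit d + debit d'   ≡⟨ +-assoc x (debit d) (debit d') ⟩
  x + (debit d + debit d') ≡⟨ cong (x +_) (+-comm (debit d) (debit d')) ⟩
  x + (debit d' + debit d) ≡⟨ +-assoc x (debit d') (debit d) ⟨
  x + debit d' + debit d   ≤⟨ +-monoˡ-≤ (debit d) hx ⟩
  credit d' + debit d      ≡⟨ +-identityʳ _ ⟨
  credit d' + debit d + 0  ≤⟨ h ⟩
  credit d + debit d'      ∎)
  where open ≤-Reasoning

≤-≼ : ∀ {a b} d → a ≤ b → b ≼ d → a ≼ d
≤-≼ d a≤b hb = ≤-trans (+-monoˡ-≤ (debit d) a≤b) hb

foldr-⊔-≼ : ∀ d x xs → x ≼ d → All (_≼ d) xs → foldr _⊔_ x xs ≼ d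
foldr-⊔-≼ d x []       hx []         = hx
foldr-⊔-≼ d x (y ∷ ys) hx (hy ∷ hys) =
  subst (_≤ credit d) (sym (+-distribʳ-⊔ (debit d) y _)) (⊔-lub hy (foldr-⊔-≼ d x ys hx hys))

foldr-⊓-≤ : ∀ x xs {y} → y ∈ x ∷ xs → foldr _⊓_ x xs ≤ y
foldr-⊓-≤ x []       (here refl)         = ≤-refl
foldr-⊓-≤ x (y ∷ ys) (here refl)         = ≤-trans (m⊓n≤n y _) (foldr-⊓-≤ x ys (here refl))
foldr-⊓-≤ x (y ∷ ys) (there (here refl)) = m⊓n≤m y _
foldr-⊓-≤ x (y ∷ ys) (there (there y∈))  = ≤-trans (m⊓n≤n y _) (foldr-⊓-≤ x ys (there y∈))

value-bound : ∀ k P → value k Maker P ≼ profile P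
breakerValue-bound : ∀ k P q → Outcome (profile P) q → value k Breaker q ≼ profile P

value-bound zero    P = score-≼ P
value-bound (suc k) P with claimP maker P | positionAnswers P
... | []     | _      = score-≼ P
... | q ∷ qs | a ∷ as = foldr-⊔-≼ (profile P) _ _ (bound a)
  (All.map⁺ (All.map (λ {q} → bound {q}) as))
  where
  bound : ∀ {q} → Answer (profile P) q → value k Breaker q ≼ profile P
  bound {q} a = breakerValue-bound k P q (outcome P q a)

breakerValue-bound zero P q (inj₂ (_ , b)) = subst (_≼ profile P) (sym (score-profile q)) b
breakerValue-bound zero P q (inj₁ a) with find a
... | q' , q'∈ , h = subst (_≼ profile P) (All.lookup (score-claimP-breaker q) q'∈)
  (descent-≼ (score q') (profile P) (profile q') h (score-≼ q'))
breakerValue-bound (suc k) P q o with claimP breaker q | o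
... | []     | inj₂ (_ , b)        = subst (_≼ profile P) (sym (score-profile q)) b
... | _ ∷ _  | inj₂ (() ∷ _ , _)
... | q₁ ∷ qs | inj₁ a with find a
...   | q' , q'∈ , h = ≤-≼ (profile P) (foldr-⊓-≤ _ _ (∈-map⁺ (value k Maker) q'∈))
  (descent-≼ (value k Maker q') (profile P) (profile q') h (value-bound k q'))

⌊n/2⌋≡n/2 : ∀ n → ⌊ n /2⌋ ≡ n / 2
⌊n/2⌋≡n/2 zero          = refl
⌊n/2⌋≡n/2 (suc zero)    = refl
⌊n/2⌋≡n/2 (suc (suc n)) =
  trans (cong suc (⌊n/2⌋≡n/2 n)) (sym (m/n≡1+[m∸n]/n (s≤s (s≤s (z≤n {n})))))

profile-++ : ∀ P Q → profile (P ++ Q) ≡ profile P ⊕ profile Q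
profile-++ []      Q = refl
profile-++ (c ∷ P) Q = trans (cong (componentProfile c ⊕_) (profile-++ P Q))
  (sym (⊕-assoc (componentProfile c) (profile P) (profile Q)))

fresh-board : ∀ k n →
  componentProfile (k , frees (suc n)) ≡ run (isMaker (leftEnd k)) (suc n) (isMaker (rightEnd k))
fresh-board k n =
  trans (runsFrom-split (leftEnd k) (suc n) (rightEnd k) [] (rightEnd-claimed k)) (⊕-identityʳ _)

fresh : Kind → List ℕ → Position
fresh k = map (λ n → (k , replicate n free))

profile-F : ∀ ls → All (1 ≤_) ls → profile (fresh KF ls) ≡ ⟨ 0 , sumF ls , N₁ ls , 0 , 0 ⟩
profile-F []           []            = refl
profile-F (suc l ∷ ls) (s≤s z≤n ∷ h) = cong₂ _⊕_ (fresh-board KF l) (profile-F ls h)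

profile-G : ∀ ms → All (1 ≤_) ms → profile (fresh KG ms) ≡ ⟨ 0 , sumG ms , N₂ ms , 0 , 0 ⟩
profile-G []           []            = refl
profile-G (suc m ∷ ms) (s≤s z≤n ∷ h) = cong₂ _⊕_ (fresh-board KG m) (profile-G ms h)

profile-H : ∀ ns → All (1 ≤_) ns → profile (fresh KH ns) ≡ ⟨ 0 , sumH ns , N₃ ns , N₅ ns , N₄ ns ⟩
profile-H []           []            = refl
profile-H (suc n ∷ ns) (s≤s z≤n ∷ h) = cong₂ _⊕_ (fresh-board KH n) (profile-H ns h)

profile-initial : ∀ ls ms ns → All (1 ≤_) ls → All (1 ≤_) ms → All (1 ≤_) ns →
  profile (initial ls ms ns)
    ≡ ⟨ 0 , sumF ls + (sumG ms + sumH ns) , N₁ ls + (N₂ ms + N₃ ns) , N₅ ns , N₄ ns ⟩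
profile-initial ls ms ns hl hm hn = begin
  profile (Fs ++ Gs ++ Hs)             ≡⟨ profile-++ Fs (Gs ++ Hs) ⟩
  profile Fs ⊕ profile (Gs ++ Hs)      ≡⟨ cong (profile Fs ⊕_) (profile-++ Gs Hs) ⟩
  profile Fs ⊕ profile Gs ⊕ profile Hs
    ≡⟨ cong₂ _⊕_ (profile-F ls hl) (cong₂ _⊕_ (profile-G ms hm) (profile-H ns hn)) ⟩
  _ ∎
  where
  open ≡-Reasoning
  Fs = fresh KF ls
  Gs = fresh KG ms
  Hs = fresh KH ns

lemma5 : (ls ms ns : List ℕ) →
    All (1 ≤_) ls → All (1 ≤_) ms → All (1 ≤_) ns →
    f ls ms ns + N₄ ns + (N₁ ls + N₂ ms + N₃ ns + ε ns) / 2
      ≤ sumF ls + sumG ms + sumH ns + ε ns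
lemma5 ls ms ns hl hm hn = subst₂ _≤_ lhs rhs bound
  where
  I = initial ls ms ns
  bound : f ls ms ns ≼ ⟨ 0 , sumF ls + (sumG ms + sumH ns) , N₁ ls + (N₂ ms + N₃ ns) , N₅ ns , N₄ ns ⟩
  bound = subst (f ls ms ns ≼_) (profile-initial ls ms ns hl hm hn) (value-bound (freeCells I) I)
  lhs : f ls ms ns + (N₄ ns + ⌊ N₁ ls + (N₂ ms + N₃ ns) + ε ns /2⌋)
      ≡ f ls ms ns + N₄ ns + (N₁ ls + N₂ ms + N₃ ns + ε ns) / 2
  lhs rewrite ⌊n/2⌋≡n/2 (N₁ ls + (N₂ ms + N₃ ns) + ε ns) | +-assoc (N₁ ls) (N₂ ms) (N₃ ns) =
    sym (+-assoc (f ls ms ns) _ _)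
  rhs : sumF ls + (sumG ms + sumH ns) + ε ns ≡ sumF ls + sumG ms + sumH ns + ε ns
  rhs = cong (_+ ε ns) (sym (+-assoc (sumF ls) (sumG ms) (sumH ns)))
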